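{- Let $R : X \leftrightarrow \mathcal{P} Y$. Then (1) $\delta_i(R) = {\downarrow}R \cap \mathsf{A}_\Cup$; (2) ${\downarrow}\delta_o(R) = -({\uparrow}(-\delta_i(R) \cap \mathsf{A}_\Cup)) = -({\uparrow}(-({\downarrow}R) \cap \mathsf{A}_\Cup))$; (3) ${\uparrow}\delta_o(R) = ({\uparrow}\delta_i(R))^d = -({\downarrow}\overline{\delta_i(R)}) = -({\downarrow}(\overline{{\downarrow}R} \cap \mathsf{A}_\Cap))$; (4) $\delta_o(R) = -({\uparrow}(-({\downarrow}R) \cap \mathsf{A}_\Cup)) \cap -({\downarrow}(\overline{{\downarrow}R} \cap \mathsf{A}_\Cap))$.
   Context: Multirelations $R : X \leftrightarrow \mathcal{P} Y$ are subsets of $X \times \mathcal{P} Y$; $-R$ denotes the complement of $R$ in $X \times \mathcal{P} Y$. $\alpha(R) = \{(a,b) \mid \exists B.\ (a,B)\in R \wedge b\in B\}$; for a relation $T$, $\Lambda(T) = \{(a,T(a)) \mid a\in X\}$ and $\eta(T) = \{(a,\{b\}) \mid (a,b)\in T\}$; $\delta_o = \Lambda\circ\alpha$, $\delta_i = \eta\circ\alpha$. Up-closure ${\uparrow}R = \{(a,A) \mid \exists B.\ (a,B)\in R \wedge B\subseteq A\}$; down-closure ${\downarrow}R = \{(a,A) \mid \exists B.\ (a,B)\in R \wedge A\subseteq B\}$. Inner complement $\overline{R} = \{(a, Y - A) \mid (a,A)\in R\}$. Duality $R^d = -\overline{R}$. Atoms $\mathsf{A}_\Cup = \{(a,\{b\})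 \mid a\in X, b\in Y\}$; co-atoms $\mathsf{A}_\Cap = \overline{\mathsf{A}_\Cup} = \{(a, Y - \{b\}) \mid a\in X, b\in Y\}$. -}

module Defs where

open import Level using (Level; _⊔_; suc)
open import Data.Product using (Σ; ∃; _×_; _,_)
open import Relation.Nullary using (¬_)
open import Relation.Unary using (Pred; _∈_; _⊆_; _≐_; ∁; ｛_｝)

-- Subsets of Y are predicates  Pred Y ℓ  (Y : Set ℓ).
-- A multirelation R : X ↔ 𝒫 Y is a predicate on X × 𝒫 Y, curried.
Mrel : ∀ {a ℓ} → Set a → Set ℓ → (r : Level) → Set _
Mrel {ℓ = ℓ} X Y r = X → Pred Y ℓ → Set r

Rel : ∀ {a ℓ} → Set a → Set ℓ → (r : Level) → Set _
Rel X Y r = X → Pred Y r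

module _ {a ℓ : Level} {X : Set a} {Y : Set ℓ} where

  α : ∀ {r} → Mrel X Y r → Rel X Y (suc ℓ ⊔ r)
  α R x y = ∃ λ (B : Pred Y ℓ) → R x B × y ∈ B

  -- Λ(T) = {(a, T(a))}   (set equality is extensional)
  Λ : ∀ {r} → Rel X Y r → Mrel X Y (ℓ ⊔ r)
  Λ T x A = A ≐ T x

  η : ∀ {r} → Rel X Y r → Mrel X Y (ℓ ⊔ r)
  η T x A = ∃ λ (b : Y) → T x b × A ≐ ｛ b ｝

  δo : ∀ {r} → Mrel X Y r → Mrel X Y (suc ℓ ⊔ r)
  δo R = Λ (α R)

  δi : ∀ {r} → Mrel X Y r → Mrel X Y (suc ℓ ⊔ r)
  δi R = η (α R)

  ↑ : ∀ {r} → Mrel X Y r → Mrel X Y (suc ℓ ⊔ r)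
  ↑ R x A = ∃ λ (B : Pred Y ℓ) → R x B × B ⊆ A

  ↓ : ∀ {r} → Mrel X Y r → Mrel X Y (suc ℓ ⊔ r)
  ↓ R x A = ∃ λ (B : Pred Y ℓ) → R x B × A ⊆ B

  -_ : ∀ {r} → Mrel X Y r → Mrel X Y r
  (- R) x A = ¬ R x A

  _∩_ : ∀ {r s} → Mrel X Y r → Mrel X Y s → Mrel X Y (r ⊔ s)
  (R ∩ S) x A = R x A × S x A

  inner : ∀ {r} → Mrel X Y r → Mrel X Y (suc ℓ ⊔ r)
  inner R x A = ∃ λ (B : Pred Y ℓ) → R x B × A ≐ ∁ B

  _ᵈ : ∀ {r} → Mrel X Y r → Mrel X Y (suc ℓ ⊔ r)
  R ᵈ = - (inner R)

  A∪ : Mrel X Y ℓ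
  A∪ x A = ∃ λ (b : Y) → A ≐ ｛ b ｝

  A∩ : Mrel X Y (suc ℓ)
  A∩ = inner A∪

  infix 4 _≋_
  _≋_ : ∀ {r s} → Mrel X Y r → Mrel X Y s → Set _
  R ≋ S = ∀ x A → (R x A → S x A) × (S x A → R x A)

{-# OPTIONS --safe #-}
module Submission where

open import Defs
open import Level using (Level; _⊔_; suc; Lift; lift; lower)
open import Data.Product using (Σ; _×_; _,_; proj₁; proj₂)
open import Data.Empty using (⊥-elim)
open import Axiom.ExcludedMiddle using (ExcludedMiddle)
open import Axiom.DoubleNegationElimination using (em⇒dne)
open import Relation.Nullary using (yes; no)
open import Relation.Nullary.Decidable using (True; toWitness; fromWitness)
open import Relation.Unary using (Pred; _⊆_; _≐_; ∁; ｛_｝)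
open import Relation.Unary.Properties using (≐-refl)
open import Relation.Binary.PropositionalEquality using (refl; subst; sym)

-- Pointwise in x, each side of clauses (2)–(4) is either the family of subsets or
-- the family of supersets of the image α R x, so the clauses reduce to
-- comparing such descriptions.  Excluded middle is needed twice: to shrink
-- α R x, which lives in a higher universe, to a subset of Y (so that Λ (α R)
-- is defined at x), and to argue by contradiction with singletons {y} and
-- co-singletons Y − {y}.

module _ {a ℓ : Level} {X : Set a} {Y : Set ℓ} where

  subsetsOf : ∀ {t} → Rel X Y t → Mrel X Y (ℓ ⊔ t)
  subsetsOf T x A = A ⊆ T x

  supersetsOf : ∀ {t} → Rel X Y t → Mrel X Y (ℓ ⊔ t)
  supersetsOf T x A = T x ⊆ A

  ≋-sym : ∀ {r s} {R : Mrel X Y r} {S : Mrel X Y s} → R ≋ S → S ≋ R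
  ≋-sym R≋S x A = proj₂ (R≋S x A) , proj₁ (R≋S x A)

  ≋-trans : ∀ {r s t} {R : Mrel X Y r} {S : Mrel X Y s} {T : Mrel X Y t} →
            R ≋ S → S ≋ T → R ≋ T
  ≋-trans R≋S S≋T x A =
      (λ Rx → proj₁ (S≋T x A) (proj₁ (R≋S x A) Rx))
    , (λ Tx → proj₂ (R≋S x A) (proj₂ (S≋T x A) Tx))

  -‿cong : ∀ {r s} {R : Mrel X Y r} {S : Mrel X Y s} → R ≋ S → - R ≋ - S
  -‿cong R≋S x A = (λ ¬R S → ¬R (proj₂ (R≋S x A) S)) , (λ ¬S R → ¬S (proj₁ (R≋S x A) R))

  ∩-cong : ∀ {r r′ s s′} {R : Mrel X Y r} {R′ : Mrel X Y r′} {S : Mrel X Y s} {S′ : Mrel X Y s′} →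
           R ≋ R′ → S ≋ S′ → R ∩ S ≋ R′ ∩ S′
  ∩-cong R≋R′ S≋S′ x A =
      (λ (Rx , Sx) → proj₁ (R≋R′ x A) Rx , proj₁ (S≋S′ x A) Sx)
    , (λ (Rx , Sx) → proj₂ (R≋R′ x A) Rx , proj₂ (S≋S′ x A) Sx)

  ↑-cong : ∀ {r s} {R : Mrel X Y r} {S : Mrel X Y s} → R ≋ S → ↑ R ≋ ↑ S
  ↑-cong R≋S x A =
      (λ (B , RB , B⊆A) → B , proj₁ (R≋S x B) RB , B⊆A)
    , (λ (B , SB , B⊆A) → B , proj₂ (R≋S x B) SB , B⊆A)

  ↓-cong : ∀ {r s} {R : Mrel X Y r} {S : Mrel X Y s} → R ≋ S → ↓ R ≋ ↓ S
  ↓-cong R≋S x A =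
      (λ (B , RB , A⊆B) → B , proj₁ (R≋S x B) RB , A⊆B)
    , (λ (B , SB , A⊆B) → B , proj₂ (R≋S x B) SB , A⊆B)

  -‿∩A∪-cong : ∀ {r s} {S : Mrel X Y r} {S′ : Mrel X Y s} →
               S ≋ S′ ∩ A∪ → (- S) ∩ A∪ ≋ (- S′) ∩ A∪
  -‿∩A∪-cong S≋S′∩A∪ x A =
      (λ (¬S , atom) → (λ S′x → ¬S (proj₂ (S≋S′∩A∪ x A) (S′x , atom))) , atom)
    , (λ (¬S′ , atom) → (λ Sx → ¬S′ (proj₁ (proj₁ (S≋S′∩A∪ x A) Sx))) , atom)

  resize : ∀ {t} → ExcludedMiddle t → (P : Pred Y t) → Σ (Pred Y ℓ) (_≐ P)
  resize em P = (λ y → Lift ℓ (True (em {P y})))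
              , (λ Py → toWitness (lower Py)) , (λ Py → lift (fromWitness Py))

  module _ {t} {T : Rel X Y t} where

    ↓Λ≋subsetsOf : ExcludedMiddle t → ↓ (Λ T) ≋ subsetsOf T
    ↓Λ≋subsetsOf em x A =
        (λ (B , (B⊆T , _) , A⊆B) → λ Ay → B⊆T (A⊆B Ay))
      , (λ A⊆T → let (Tx , Tx≐) = resize em (T x) in Tx , Tx≐ , λ Ay → proj₂ Tx≐ (A⊆T Ay))

    ↑Λ≋supersetsOf : ExcludedMiddle t → ↑ (Λ T) ≋ supersetsOf T
    ↑Λ≋supersetsOf em x A =
        (λ (B , (_ , T⊆B) , B⊆A) → λ Ty → B⊆A (T⊆B Ty))
      , (λ T⊆A → let (Tx , Tx≐) = resize em (T x) in Tx , Tx≐ , λ Ty → T⊆A (proj₁ Tx≐ Ty))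

    -↑[-η∩A∪]≋subsetsOf : ExcludedMiddle t → - ↑ ((- η T) ∩ A∪) ≋ subsetsOf T
    -↑[-η∩A∪]≋subsetsOf em x A = (λ h {y} Ay → inT h y Ay) , notAbove
      where
      inT : (- ↑ ((- η T) ∩ A∪)) x A → ∀ y → A y → T x y
      inT h y Ay with em {T x y}
      ... | yes Txy = Txy
      ... | no ¬Txy = ⊥-elim (h (｛ y ｝ , ((λ (b , Txb , (y⊆b , _)) → ¬Txy (subst (T x) (y⊆b refl) Txb))
                                          , (y , ≐-refl))
                                , λ y≡z → subst A y≡z Ay))
      notAbove : subsetsOf T x A → (- ↑ ((- η T) ∩ A∪)) x A
      notAbove A⊆T (B , (¬ηB , (b , B≐b)) , B⊆A) = ¬ηB (b , A⊆T (B⊆A (proj₂ B≐b refl)) , B≐b)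

    ↑ηᵈ≋supersetsOf : ExcludedMiddle ℓ → (↑ (η T)) ᵈ ≋ supersetsOf T
    ↑ηᵈ≋supersetsOf em x A = (λ h {y} Ty → inA h y Ty) , notDual
      where
      inA : ((↑ (η T)) ᵈ) x A → ∀ y → T x y → A y
      inA h y Ty with em {A y}
      ... | yes Ay = Ay
      ... | no ¬Ay = ⊥-elim (h (∁ A , (｛ y ｝ , (y , Ty , ≐-refl) , λ y≡z Az → ¬Ay (subst A (sym y≡z) Az))
                                   , (λ Az ¬Az → ¬Az Az) , em⇒dne em))
      notDual : supersetsOf T x A → ((↑ (η T)) ᵈ) x A
      notDual T⊆A (B , (C , (b , Tb , C≐b) , C⊆B) , A≐∁B) = proj₁ A≐∁B (T⊆A Tb) (C⊆B (proj₂ C≐b refl))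

    -↓innerη≋supersetsOf : ExcludedMiddle ℓ → - ↓ (inner (η T)) ≋ supersetsOf T
    -↓innerη≋supersetsOf em x A = (λ h {y} Ty → inA h y Ty) , notBelow
      where
      inA : (- ↓ (inner (η T))) x A → ∀ y → T x y → A y
      inA h y Ty with em {A y}
      ... | yes Ay = Ay
      ... | no ¬Ay = ⊥-elim (h (∁ ｛ y ｝ , (｛ y ｝ , (y , Ty , ≐-refl) , ≐-refl)
                                      , λ Az y≡z → ¬Ay (subst A (sym y≡z) Az)))
      notBelow : supersetsOf T x A → (- ↓ (inner (η T))) x A
      notBelow T⊆A (B , (C , (b , Tb , C≐b) , B≐∁C) , A⊆B) = proj₁ B≐∁C (A⊆B (T⊆A Tb)) (proj₂ C≐b refl)

  module _ {r} (R : Mrel X Y r) where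

    δi≋↓∩A∪ : δi R ≋ ↓ R ∩ A∪
    δi≋↓∩A∪ x A =
        (λ (b , (B , RB , Bb) , A≐b) → (B , RB , λ Ay → subst B (proj₁ A≐b Ay) Bb) , (b , A≐b))
      , (λ ((B , RB , A⊆B) , (b , A≐b)) → b , (B , RB , A⊆B (proj₂ A≐b refl)) , A≐b)

    -- Recovering b ∈ C from ∁ C ≐ ∁ {b} needs double negation elimination.
    innerδi≋inner↓∩A∩ : ExcludedMiddle ℓ → inner (δi R) ≋ inner (↓ R) ∩ A∩
    innerδi≋inner↓∩A∩ em x A = toCoatom , fromCoatom
      where
      toCoatom : inner (δi R) x A → (inner (↓ R) ∩ A∩) x A
      toCoatom (C , (b , (D , RD , Db) , C≐b) , A≐∁C) =
          (C , (D , RD , λ Cz → subst D (proj₁ C≐b Cz) Db) , A≐∁C)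
        , (C , (b , C≐b) , A≐∁C)
      fromCoatom : (inner (↓ R) ∩ A∩) x A → inner (δi R) x A
      fromCoatom ((C , (D , RD , C⊆D) , A≐∁C) , (E , (b , E≐b) , A≐∁E)) =
        E , (b , (D , RD , C⊆D Cb) , E≐b) , A≐∁E
        where
        Cb : C b
        Cb = em⇒dne em (λ ¬Cb → proj₁ A≐∁E (proj₂ A≐∁C ¬Cb) (proj₂ E≐b refl))

lemma3p14 : {a ℓ r : Level} {X : Set a} {Y : Set ℓ} →
    ExcludedMiddle ℓ → ExcludedMiddle (suc ℓ ⊔ r) →
    (R : Mrel X Y r) →
      (δi R ≋ (↓ R ∩ A∪))
      × ((↓ (δo R) ≋ - (↑ ((- (δi R)) ∩ A∪)))
        × (- (↑ ((- (δi R)) ∩ A∪)) ≋ - (↑ ((- (↓ R)) ∩ A∪))))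
      × ((↑ (δo R) ≋ (↑ (δi R)) ᵈ)
        × ((↑ (δi R)) ᵈ ≋ - (↓ (inner (δi R))))
        × (- (↓ (inner (δi R))) ≋ - (↓ ((inner (↓ R)) ∩ A∩))))
      × (δo R ≋ ((- (↑ ((- (↓ R)) ∩ A∪))) ∩ (- (↓ ((inner (↓ R)) ∩ A∩)))))
lemma3p14 emY emα R =
    δi≋↓∩A∪ R
  , (≋-trans (↓Λ≋subsetsOf emα) (≋-sym (-↑[-η∩A∪]≋subsetsOf emα)) , lowerSwap)
  , ( ≋-trans (↑Λ≋supersetsOf emα) (≋-sym (↑ηᵈ≋supersetsOf emY))
    , ≋-trans (↑ηᵈ≋supersetsOf emY) (≋-sym (-↓innerη≋supersetsOf emY))
    , upperSwap )
  , ≋-sym (∩-cong below above)  -- δo R x A unfolds to (subsetsOf (α R) ∩ supersetsOf (α R)) x A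
  where
  lowerSwap : - ↑ ((- δi R) ∩ A∪) ≋ - ↑ ((- ↓ R) ∩ A∪)
  lowerSwap = -‿cong (↑-cong (-‿∩A∪-cong (δi≋↓∩A∪ R)))
  upperSwap : - ↓ (inner (δi R)) ≋ - ↓ (inner (↓ R) ∩ A∩)
  upperSwap = -‿cong (↓-cong (innerδi≋inner↓∩A∩ R emY))
  below : - ↑ ((- ↓ R) ∩ A∪) ≋ subsetsOf (α R)
  below = ≋-trans (≋-sym lowerSwap) (-↑[-η∩A∪]≋subsetsOf emα)
  above : - ↓ (inner (↓ R) ∩ A∩) ≋ supersetsOf (α R)
  above = ≋-trans (≋-sym upperSwap) (-↓innerη≋supersetsOf emY)
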